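{- For $n\ge0$ let $A_n$ be the number of elements of $C_2\wr S_n$ that bi-avoid the pattern $(1\text{ - }2,\,0~1)$ (with $A_0=1$). Then $$\sum_{n\ge0}A_n\frac{x^n}{n!}=\frac{e^{\frac{x}{1-x}}}{1-x}.$$
   Context: $C_2\wr S_n$ denotes the set of pairs $(\sigma,w)$ where $\sigma=\sigma_1\cdots\sigma_n$ is a permutation of $\{1,\dots,n\}$ in one-line notation and $w=w_1\cdots w_n\in\{0,1\}^n$. The element $(\sigma,w)$ bi-avoids the pattern $(1\text{ - }2,\,0~1)$ if there are no indices $i<j$ with $\sigma_i<\sigma_j$ and $w_i<w_j$ (i.e. $w_i=0$, $w_j=1$). -}

module Defs where

open import Data.Bool using (Bool; true; false; _∧_; _∨_; not)
open import Data.Nat using (ℕ; zero; suc; _!; _∸_)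
open import Data.Nat.Properties using (_!≢0)
open import Data.Fin using (Fin; toℕ) renaming (zero to fz; suc to fs)
open import Data.Fin.Properties using () renaming (_≟_ to _≟ᶠ_)
open import Data.Nat.Properties using (_<?_)
open import Data.Vec using (Vec; []; _∷_; lookup)
open import Data.List using (List; []; _∷_; concatMap; map; filter; length; allFin; upTo; foldr)
open import Data.Bool.ListAction using (and; or)
open import Data.Product using (_×_; _,_)
open import Data.Integer using (+_)
open import Data.Rational using (ℚ; _/_; _+_; _*_; 0ℚ; 1ℚ)
open import Relation.Nullary.Decidable using (⌊_⌋)

allVecs : {A : Set} → List A → (k : ℕ) → List (Vec A k)
allVecs xs zero = [] ∷ []
allVecs xs (suc k) = concatMap (λ x → map (x ∷_) (allVecs xs k)) xs

_<ᵇ_ : {n : ℕ} → Fin n → Fin n → Bool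
i <ᵇ j = ⌊ toℕ i <? toℕ j ⌋

-- σ (a word σ₁⋯σₙ over {1..n}, encoded as Fin n) is a permutation:
-- its entries are pairwise distinct (injective, hence bijective on Fin n)
isPerm : {n : ℕ} → Vec (Fin n) n → Bool
isPerm {n} σ = and (concatMap (λ i → map (λ j →
  (not (i <ᵇ j)) ∨ not ⌊ lookup σ i ≟ᶠ lookup σ j ⌋) (allFin n)) (allFin n))

-- (σ , w) contains (1-2, 0 1): indices i < j with σᵢ < σⱼ, wᵢ = 0, wⱼ = 1
contains12-01 : {n : ℕ} → Vec (Fin n) n → Vec (Fin 2) n → Bool
contains12-01 {n} σ w = or (concatMap (λ i → map (λ j →
  (i <ᵇ j) ∧ (lookup σ i <ᵇ lookup σ j) ∧ (lookup w i <ᵇ lookup w j))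
  (allFin n)) (allFin n))

biAvoids12-01 : {n : ℕ} → Vec (Fin n) n → Vec (Fin 2) n → Bool
biAvoids12-01 σ w = not (contains12-01 σ w)

wreath : (n : ℕ) → List (Vec (Fin n) n × Vec (Fin 2) n)
wreath n = concatMap (λ σ → map (σ ,_) (allVecs (allFin 2) n))
                     (filter (λ σ → isPerm σ Data.Bool.≟ true) (allVecs (allFin n) n))

A : ℕ → ℕ
A n = length (filter (λ p → biAvoids12-01 (Data.Product.proj₁ p) (Data.Product.proj₂ p) Data.Bool.≟ true) (wreath n))

FPS : Set
FPS = ℕ → ℚ

sumTo : ℕ → (ℕ → ℚ) → ℚ
sumTo n f = foldr (λ i acc → f i + acc) 0ℚ (upTo (suc n))

_⊛_ : FPS → FPS → FPS
(f ⊛ g) n = sumTo n (λ i → f i * g (n ∸ i))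

pow : FPS → ℕ → FPS
pow f zero zero = 1ℚ
pow f zero (suc n) = 0ℚ
pow f (suc k) = f ⊛ pow f k

-- exp of a series f with zero constant term: Σ_k f^k / k!.
-- Since f 0 = 0, f^k has no coefficient below x^k, so the coefficient
-- of xⁿ only involves k ≤ n (the sum below is exact in that case).
expS : FPS → FPS
expS f n = sumTo n (λ k → (+ 1 / (k !)) {{k !≢0}} * pow f k n)

geom : FPS
geom n = 1ℚ

xOver1-x : FPS
xOver1-x zero = 0ℚ
xOver1-x (suc n) = 1ℚ

egf : (ℕ → ℕ) → FPS
egf a n = (+ a n / (n !)) {{n !≢0}}

-- Read σ from left to right. A letter labelled 1 is admissible exactly when it lies below every
-- earlier letter labelled 0, so the labellings w bi-avoiding the pattern with a given σ can be
-- counted by a scan that only remembers this bound. Choosing the first letter of σ by its rank r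
-- among the remaining letters, the number a(k, t) of such pairs of length k whose bound exceeds t
-- of the letters satisfies a(k + 1, t) = Σ_{r ≤ k} (a(k, min(r, t)) + [r < t] a(k, t − 1)), which
-- is solved by a(k, t) = k! Σⱼ C(t, j) / j!. On the other side, [xⁱ] (x/(1−x))ʲ = C(i − 1, j − 1),
-- so the coefficient of xⁿ in e^{x/(1−x)}/(1−x) is Σⱼ C(n, j) / j! as well.
module Submission where

module Sums where

  open import Defs using (allVecs)
  open import Data.Bool using (Bool; true; false; _∧_; _≟_)
  open import Data.List using (List; []; _∷_; _++_; map; concatMap; filter; length)
  open import Data.List.Membership.Propositional using (_∈_)
  open import Data.List.Relation.Unary.All using (All; []; _∷_)
  open import Data.List.Relation.Unary.Any using (here; there)
  open import Data.Nat using (ℕ; zero; suc; _+_; _*_; _≤_; z≤n)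
  open import Data.Nat.Properties using (+-assoc; +-identityʳ; *-zeroʳ; *-distribˡ-+; +-mono-≤)
  open import Data.Nat.Solver using (module +-*-Solver)
  open import Data.Vec using (Vec; _∷_)
  import Data.Vec as Vec
  open import Function using (_∘_)
  open import Relation.Binary.PropositionalEquality
  open +-*-Solver using (solve; _:+_; _:=_)
  open ≡-Reasoning

  private
    variable
      X Y : Set

  ⟦_⟧ : Bool → ℕ
  ⟦ true ⟧ = 1
  ⟦ false ⟧ = 0

  ⟦⟧-∧ : (a b : Bool) → ⟦ a ∧ b ⟧ ≡ ⟦ a ⟧ * ⟦ b ⟧
  ⟦⟧-∧ true b = sym (+-identityʳ ⟦ b ⟧)
  ⟦⟧-∧ false b = refl

  sumBy : (X → ℕ) → List X → ℕ
  sumBy f [] = 0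
  sumBy f (x ∷ xs) = f x + sumBy f xs

  sumBy-cong : {f g : X → ℕ} (xs : List X) → (∀ x → f x ≡ g x) → sumBy f xs ≡ sumBy g xs
  sumBy-cong [] f≗g = refl
  sumBy-cong (x ∷ xs) f≗g = cong₂ _+_ (f≗g x) (sumBy-cong xs f≗g)

  sumBy-cong-All : {P : X → Set} {f g : X → ℕ} {xs : List X} →
                   (∀ {x} → P x → f x ≡ g x) → All P xs → sumBy f xs ≡ sumBy g xs
  sumBy-cong-All f≗g [] = refl
  sumBy-cong-All f≗g (px ∷ pxs) = cong₂ _+_ (f≗g px) (sumBy-cong-All f≗g pxs)

  sumBy-cong-∈ : {f g : X → ℕ} (xs : List X) → (∀ {x} → x ∈ xs → f x ≡ g x) →
                 sumBy f xs ≡ sumBy g xs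
  sumBy-cong-∈ [] f≗g = refl
  sumBy-cong-∈ (x ∷ xs) f≗g = cong₂ _+_ (f≗g (here refl)) (sumBy-cong-∈ xs (f≗g ∘ there))

  sumBy-mono : {f g : X → ℕ} (xs : List X) → (∀ x → f x ≤ g x) → sumBy f xs ≤ sumBy g xs
  sumBy-mono [] f≤g = z≤n
  sumBy-mono (x ∷ xs) f≤g = +-mono-≤ (f≤g x) (sumBy-mono xs f≤g)

  sumBy-+ : (f g : X → ℕ) (xs : List X) → sumBy (λ x → f x + g x) xs ≡ sumBy f xs + sumBy g xs
  sumBy-+ f g [] = refl
  sumBy-+ f g (x ∷ xs) rewrite sumBy-+ f g xs =
    solve 4 (λ a b c d → (a :+ b) :+ (c :+ d) := (a :+ c) :+ (b :+ d)) refl (f x) (g x) (sumBy f xs) (sumBy g xs)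

  sumBy-*ˡ : (c : ℕ) (f : X → ℕ) (xs : List X) → sumBy (λ x → c * f x) xs ≡ c * sumBy f xs
  sumBy-*ˡ c f [] = sym (*-zeroʳ c)
  sumBy-*ˡ c f (x ∷ xs) rewrite sumBy-*ˡ c f xs = sym (*-distribˡ-+ c (f x) (sumBy f xs))

  sumBy-++ : (f : X → ℕ) (xs ys : List X) → sumBy f (xs ++ ys) ≡ sumBy f xs + sumBy f ys
  sumBy-++ f [] ys = refl
  sumBy-++ f (x ∷ xs) ys = trans (cong (f x +_) (sumBy-++ f xs ys)) (sym (+-assoc (f x) _ _))

  sumBy-concatMap : (f : Y → ℕ) (g : X → List Y) (xs : List X) →
                    sumBy f (concatMap g xs) ≡ sumBy (sumBy f ∘ g) xs
  sumBy-concatMap f g [] = refl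
  sumBy-concatMap f g (x ∷ xs) =
    trans (sumBy-++ f (g x) (concatMap g xs)) (cong (sumBy f (g x) +_) (sumBy-concatMap f g xs))

  sumBy-map : (f : Y → ℕ) (g : X → Y) (xs : List X) → sumBy f (map g xs) ≡ sumBy (f ∘ g) xs
  sumBy-map f g [] = refl
  sumBy-map f g (x ∷ xs) = cong (f (g x) +_) (sumBy-map f g xs)

  length-filter≡sumBy : (P : X → Bool) (xs : List X) →
                        length (filter (λ x → P x ≟ true) xs) ≡ sumBy (⟦_⟧ ∘ P) xs
  length-filter≡sumBy P [] = refl
  length-filter≡sumBy P (x ∷ xs) with P x
  ... | true = cong suc (length-filter≡sumBy P xs)
  ... | false = length-filter≡sumBy P xs

  sumBy-filter : (P : X → Bool) (f : X → ℕ) (xs : List X) →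
                 sumBy f (filter (λ x → P x ≟ true) xs) ≡ sumBy (λ x → ⟦ P x ⟧ * f x) xs
  sumBy-filter P f [] = refl
  sumBy-filter P f (x ∷ xs) with P x
  ... | true = cong₂ _+_ (sym (+-identityʳ (f x))) (sumBy-filter P f xs)
  ... | false = sumBy-filter P f xs

  sumBy-allVecs-map : (f : X → Y) (xs : List X) (k : ℕ) (F : Vec Y k → ℕ) →
    sumBy F (allVecs (map f xs) k) ≡ sumBy (F ∘ Vec.map f) (allVecs xs k)
  sumBy-allVecs-map f xs zero F = refl
  sumBy-allVecs-map f xs (suc k) F = begin
    sumBy F (concatMap (λ y → map (y ∷_) (allVecs (map f xs) k)) (map f xs))
      ≡⟨ sumBy-concatMap F _ (map f xs) ⟩
    sumBy (λ y → sumBy F (map (y ∷_) (allVecs (map f xs) k))) (map f xs)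
      ≡⟨ sumBy-map _ f xs ⟩
    sumBy (λ x → sumBy F (map (f x ∷_) (allVecs (map f xs) k))) xs
      ≡⟨ sumBy-cong xs (λ x → trans (sumBy-map F (f x ∷_) (allVecs (map f xs) k))
                                    (sumBy-allVecs-map f xs k (F ∘ (f x ∷_)))) ⟩
    sumBy (λ x → sumBy (λ s → F (f x ∷ Vec.map f s)) (allVecs xs k)) xs
      ≡⟨ sumBy-cong xs (λ x → sumBy-map _ (x ∷_) (allVecs xs k)) ⟨
    sumBy (λ x → sumBy (F ∘ Vec.map f) (map (x ∷_) (allVecs xs k))) xs
      ≡⟨ sumBy-concatMap _ _ xs ⟨
    sumBy (F ∘ Vec.map f) (concatMap (λ x → map (x ∷_) (allVecs xs k)) xs) ∎

module Comparisons where

  open import Data.Bool using (true; false; _∧_; not)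
  open import Data.Bool.Properties using (∧-zeroʳ)
  open import Data.Nat using (ℕ; zero; suc; _⊓_; _≤_; _<_; z≤n; s≤s; _<ᵇ_; _≡ᵇ_)
  open import Relation.Binary.PropositionalEquality

  private
    variable
      m n : ℕ

  <⇒<ᵇ≡true : m < n → (m <ᵇ n) ≡ true
  <⇒<ᵇ≡true {zero} (s≤s _) = refl
  <⇒<ᵇ≡true {suc m} (s≤s m<n) = <⇒<ᵇ≡true m<n

  ≤⇒>ᵇ≡false : n ≤ m → (m <ᵇ n) ≡ false
  ≤⇒>ᵇ≡false {zero} _ = refl
  ≤⇒>ᵇ≡false {suc n} (s≤s n≤m) = ≤⇒>ᵇ≡false n≤m

  <ᵇ≡true⇒< : (m <ᵇ n) ≡ true → m < n
  <ᵇ≡true⇒< {zero} {suc n} _ = s≤s z≤n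
  <ᵇ≡true⇒< {suc m} {suc n} eq = s≤s (<ᵇ≡true⇒< eq)

  <ᵇ≡false⇒≥ : (m <ᵇ n) ≡ false → n ≤ m
  <ᵇ≡false⇒≥ {m} {zero} _ = z≤n
  <ᵇ≡false⇒≥ {suc m} {suc n} eq = s≤s (<ᵇ≡false⇒≥ eq)

  ≡ᵇ-refl : ∀ m → (m ≡ᵇ m) ≡ true
  ≡ᵇ-refl zero = refl
  ≡ᵇ-refl (suc m) = ≡ᵇ-refl m

  <⇒≡ᵇ≡false : m < n → (m ≡ᵇ n) ≡ false
  <⇒≡ᵇ≡false {zero} (s≤s _) = refl
  <⇒≡ᵇ≡false {suc m} (s≤s m<n) = <⇒≡ᵇ≡false m<n

  >⇒≡ᵇ≡false : n < m → (m ≡ᵇ n) ≡ false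
  >⇒≡ᵇ≡false {zero} {suc m} _ = refl
  >⇒≡ᵇ≡false {suc n} (s≤s n<m) = >⇒≡ᵇ≡false n<m

  <ᵇ-⊓ : ∀ y x t → (y <ᵇ x ⊓ t) ≡ (y <ᵇ x) ∧ (y <ᵇ t)
  <ᵇ-⊓ y zero t = refl
  <ᵇ-⊓ y (suc x) zero = sym (∧-zeroʳ _)
  <ᵇ-⊓ zero (suc x) (suc t) = refl
  <ᵇ-⊓ (suc y) (suc x) (suc t) = <ᵇ-⊓ y x t

  <ᵇ-suc-⊓ : ∀ y x t → (y <ᵇ suc x ⊓ t) ≡ (y <ᵇ t) ∧ not (x <ᵇ y)
  <ᵇ-suc-⊓ y x zero = refl
  <ᵇ-suc-⊓ zero x (suc t) = refl
  <ᵇ-suc-⊓ (suc y) zero (suc t) = sym (∧-zeroʳ _)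
  <ᵇ-suc-⊓ (suc y) (suc x) (suc t) = <ᵇ-suc-⊓ y x t

  <ᵇ-trichotomy : ∀ x y → (y <ᵇ x) ≡ not (x ≡ᵇ y) ∧ not (x <ᵇ y)
  <ᵇ-trichotomy zero zero = refl
  <ᵇ-trichotomy zero (suc y) = refl
  <ᵇ-trichotomy (suc x) zero = refl
  <ᵇ-trichotomy (suc x) (suc y) = <ᵇ-trichotomy x y

module Enumeration where

  open Sums
  open Comparisons using (<ᵇ-suc-⊓)
  open import Defs hiding (_<ᵇ_)
  import Defs
  open import Data.Bool using (Bool; true; false; _∧_; _∨_; not; _≟_)
  open import Data.Bool.Properties using (∧-assoc; ∧-zeroʳ; ∧-identityʳ)
  open import Data.Bool.ListAction using (and; or)
  open import Data.Fin using (Fin; toℕ) renaming (zero to fzero; suc to fsuc)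
  open import Data.Fin.Properties using () renaming (_≟_ to _≟ᶠ_)
  open import Data.List using (List; []; _∷_; _++_; map; concatMap; filter; foldr; tabulate; allFin; upTo; applyUpTo)
  import Data.List.Properties as List
  open import Data.Nat using (ℕ; zero; suc; _*_; _⊓_; _<ᵇ_; _≡ᵇ_)
  open import Data.Nat.Properties using (_<?_)
  open import Data.Product using (_×_; _,_; proj₁; proj₂)
  open import Data.Vec using (Vec; []; _∷_; lookup)
  import Data.Vec as Vec
  import Data.Vec.Properties as Vec
  open import Function using (_∘_)
  open import Relation.Binary.PropositionalEquality
  open import Relation.Nullary.Decidable using (⌊_⌋; isYes≗does)
  open ≡-Reasoning

  private
    variable
      k : ℕ

  or-++ : (bs cs : List Bool) → or (bs ++ cs) ≡ or bs ∨ or cs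
  or-++ [] cs = refl
  or-++ (true ∷ bs) cs = refl
  or-++ (false ∷ bs) cs = or-++ bs cs

  and-++ : (bs cs : List Bool) → and (bs ++ cs) ≡ and bs ∧ and cs
  and-++ [] cs = refl
  and-++ (true ∷ bs) cs = and-++ bs cs
  and-++ (false ∷ bs) cs = refl

  foldr-concatMap-allFin : {A : Set} {_⊕_ : A → A → A} {e : A} →
    (∀ xs ys → foldr _⊕_ e (xs ++ ys) ≡ foldr _⊕_ e xs ⊕ foldr _⊕_ e ys) →
    (P Q : Fin k → Fin k → A) → (∀ i j → P i j ≡ Q i j) →
    foldr _⊕_ e (concatMap (λ i → map (P i) (allFin k)) (allFin k))
      ≡ foldr _⊕_ e (tabulate λ i → foldr _⊕_ e (tabulate (Q i)))
  foldr-concatMap-allFin {k} {A} {_⊕_} {e} fold-++ P Q P≗Q = begin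
    big (concatMap row (allFin k))                  ≡⟨ fold-concatMap (allFin k) ⟩
    big (map (big ∘ row) (allFin k))                ≡⟨ cong big (List.map-tabulate (λ i → i) (big ∘ row)) ⟩
    big (tabulate (big ∘ row))                      ≡⟨ cong big (List.tabulate-cong (cong big ∘ row≡)) ⟩
    big (tabulate λ i → big (tabulate (Q i))) ∎
    where
    big : List A → A
    big = foldr _⊕_ e
    row : Fin k → List A
    row i = map (P i) (allFin k)
    row≡ : ∀ i → row i ≡ tabulate (Q i)
    row≡ i = trans (List.map-tabulate (λ j → j) (P i)) (List.tabulate-cong (P≗Q i))
    fold-concatMap : (is : List (Fin k)) → big (concatMap row is) ≡ big (map (big ∘ row) is)
    fold-concatMap [] = refl
    fold-concatMap (i ∷ is) =
      trans (fold-++ (row i) (concatMap row is)) (cong (big (row i) ⊕_) (fold-concatMap is))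

  <ᵇ-toℕ : (i j : Fin k) → (i Defs.<ᵇ j) ≡ (toℕ i <ᵇ toℕ j)
  <ᵇ-toℕ i j = isYes≗does (toℕ i <? toℕ j)

  ≟ᶠ-toℕ : (i j : Fin k) → ⌊ i ≟ᶠ j ⌋ ≡ (toℕ i ≡ᵇ toℕ j)
  ≟ᶠ-toℕ fzero fzero = refl
  ≟ᶠ-toℕ fzero (fsuc j) = refl
  ≟ᶠ-toℕ (fsuc i) fzero = refl
  ≟ᶠ-toℕ (fsuc i) (fsuc j) =
    trans (isYes≗does (fsuc i ≟ᶠ fsuc j)) (trans (sym (isYes≗does (i ≟ᶠ j))) (≟ᶠ-toℕ i j))

  orᶠ andᶠ : (Fin k → Bool) → Bool
  orᶠ f = or (tabulate f)
  andᶠ f = and (tabulate f)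

  _∉ᵇ_ : ℕ → Vec ℕ k → Bool
  x ∉ᵇ [] = true
  x ∉ᵇ (y ∷ s) = not (x ≡ᵇ y) ∧ (x ∉ᵇ s)

  distinct : Vec ℕ k → Bool
  distinct [] = true
  distinct (x ∷ s) = (x ∉ᵇ s) ∧ distinct s

  isPerm≡distinct : {n : ℕ} (σ : Vec (Fin n) n) → isPerm σ ≡ distinct (Vec.map toℕ σ)
  isPerm≡distinct {n} σ = trans (foldr-concatMap-allFin and-++ P (Q s) P≡Q) (pairwise≡distinct s)
    where
    s : Vec ℕ n
    s = Vec.map toℕ σ
    P : Fin n → Fin n → Bool
    P i j = not (i Defs.<ᵇ j) ∨ not ⌊ lookup σ i ≟ᶠ lookup σ j ⌋
    Q : (s : Vec ℕ k) → Fin k → Fin k → Bool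
    Q s i j = not (toℕ i <ᵇ toℕ j) ∨ not (lookup s i ≡ᵇ lookup s j)
    P≡Q : ∀ i j → P i j ≡ Q s i j
    P≡Q i j rewrite <ᵇ-toℕ i j | ≟ᶠ-toℕ (lookup σ i) (lookup σ j)
                  | Vec.lookup-map i toℕ σ | Vec.lookup-map j toℕ σ = refl
    ∉ᵇ≡andᶠ : (x : ℕ) (s : Vec ℕ k) → andᶠ (λ j → not (x ≡ᵇ lookup s j)) ≡ x ∉ᵇ s
    ∉ᵇ≡andᶠ x [] = refl
    ∉ᵇ≡andᶠ x (y ∷ s) = cong (not (x ≡ᵇ y) ∧_) (∉ᵇ≡andᶠ x s)
    pairwise≡distinct : (s : Vec ℕ k) → andᶠ (λ i → andᶠ (Q s i)) ≡ distinct s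
    pairwise≡distinct [] = refl
    pairwise≡distinct (x ∷ s) = cong₂ _∧_ (∉ᵇ≡andᶠ x s) (pairwise≡distinct s)

  someAbove : ℕ → ℕ → Vec ℕ k → Vec ℕ k → Bool
  someAbove x y s u = orᶠ λ j → (x <ᵇ lookup s j) ∧ (y <ᵇ lookup u j)

  -- containsPattern (x ∷ s) (y ∷ u) reduces to someAbove x y s u ∨ containsPattern s u.
  containsPattern : Vec ℕ k → Vec ℕ k → Bool
  containsPattern s u =
    orᶠ λ i → orᶠ λ j → (toℕ i <ᵇ toℕ j) ∧ (lookup s i <ᵇ lookup s j) ∧ (lookup u i <ᵇ lookup u j)

  contains12-01≡containsPattern : {n : ℕ} (σ : Vec (Fin n) n) (w : Vec (Fin 2) n) →
    contains12-01 σ w ≡ containsPattern (Vec.map toℕ σ) (Vec.map toℕ w)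
  contains12-01≡containsPattern {n} σ w = foldr-concatMap-allFin or-++ P Q P≡Q
    where
    s u : Vec ℕ n
    s = Vec.map toℕ σ
    u = Vec.map toℕ w
    P Q : Fin n → Fin n → Bool
    P i j = (i Defs.<ᵇ j) ∧ (lookup σ i Defs.<ᵇ lookup σ j) ∧ (lookup w i Defs.<ᵇ lookup w j)
    Q i j = (toℕ i <ᵇ toℕ j) ∧ (lookup s i <ᵇ lookup s j) ∧ (lookup u i <ᵇ lookup u j)
    P≡Q : ∀ i j → P i j ≡ Q i j
    P≡Q i j rewrite <ᵇ-toℕ i j | <ᵇ-toℕ (lookup σ i) (lookup σ j) | <ᵇ-toℕ (lookup w i) (lookup w j)
                  | Vec.lookup-map i toℕ σ | Vec.lookup-map j toℕ σ
                  | Vec.lookup-map i toℕ w | Vec.lookup-map j toℕ w = refl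

  onesBelow : ℕ → Vec ℕ k → Vec (Fin 2) k → Bool
  onesBelow t [] [] = true
  onesBelow t (x ∷ s) (fzero ∷ w) = onesBelow t s w
  onesBelow t (x ∷ s) (fsuc _ ∷ w) = (x <ᵇ t) ∧ onesBelow t s w

  -- Scanning left to right, a letter x labelled 0 lowers the bound for later letters labelled 1 to x + 1.
  avoidsBelow : ℕ → Vec ℕ k → Vec (Fin 2) k → Bool
  avoidsBelow t [] [] = true
  avoidsBelow t (x ∷ s) (fzero ∷ w) = avoidsBelow (suc x ⊓ t) s w
  avoidsBelow t (x ∷ s) (fsuc _ ∷ w) = (x <ᵇ t) ∧ avoidsBelow t s w

  ∧-not-interchange : (a b c d : Bool) → (a ∧ not b) ∧ (c ∧ not d) ≡ (a ∧ c) ∧ not (b ∨ d)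
  ∧-not-interchange true true c d = sym (∧-zeroʳ c)
  ∧-not-interchange true false c d = refl
  ∧-not-interchange false b c d = refl

  ∧-not-∨ : (a b c : Bool) → (a ∧ not b) ∧ not c ≡ a ∧ not (b ∨ c)
  ∧-not-∨ true true c = refl
  ∧-not-∨ true false c = refl
  ∧-not-∨ false b c = refl

  onesBelow-suc-⊓ : (x t : ℕ) (s : Vec ℕ k) (w : Vec (Fin 2) k) →
    onesBelow (suc x ⊓ t) s w ≡ onesBelow t s w ∧ not (someAbove x 0 s (Vec.map toℕ w))
  onesBelow-suc-⊓ x t [] [] = refl
  onesBelow-suc-⊓ x t (y ∷ s) (fzero ∷ w) rewrite ∧-zeroʳ (x <ᵇ y) = onesBelow-suc-⊓ x t s w
  onesBelow-suc-⊓ x t (y ∷ s) (fsuc fzero ∷ w)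
    rewrite <ᵇ-suc-⊓ y x t | onesBelow-suc-⊓ x t s w | ∧-identityʳ (x <ᵇ y) =
    ∧-not-interchange (y <ᵇ t) (x <ᵇ y) _ _

  someAbove-1≡false : (x : ℕ) (s : Vec ℕ k) (w : Vec (Fin 2) k) → someAbove x 1 s (Vec.map toℕ w) ≡ false
  someAbove-1≡false x [] [] = refl
  someAbove-1≡false x (y ∷ s) (fzero ∷ w) rewrite ∧-zeroʳ (x <ᵇ y) = someAbove-1≡false x s w
  someAbove-1≡false x (y ∷ s) (fsuc fzero ∷ w) rewrite ∧-zeroʳ (x <ᵇ y) = someAbove-1≡false x s w

  avoidsBelow-spec : (t : ℕ) (s : Vec ℕ k) (w : Vec (Fin 2) k) →
    avoidsBelow t s w ≡ onesBelow t s w ∧ not (containsPattern s (Vec.map toℕ w))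
  avoidsBelow-spec t [] [] = refl
  avoidsBelow-spec t (x ∷ s) (fzero ∷ w)
    rewrite avoidsBelow-spec (suc x ⊓ t) s w | onesBelow-suc-⊓ x t s w = ∧-not-∨ (onesBelow t s w) _ _
  avoidsBelow-spec t (x ∷ s) (fsuc fzero ∷ w)
    rewrite avoidsBelow-spec t s w | someAbove-1≡false x s w = sym (∧-assoc (x <ᵇ t) _ _)

  toℕ<ᵇn : {n : ℕ} (v : Fin n) → (toℕ v <ᵇ n) ≡ true
  toℕ<ᵇn fzero = refl
  toℕ<ᵇn (fsuc v) = toℕ<ᵇn v

  onesBelow-bound : {n : ℕ} (σ : Vec (Fin n) k) (w : Vec (Fin 2) k) → onesBelow n (Vec.map toℕ σ) w ≡ true
  onesBelow-bound [] [] = refl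
  onesBelow-bound (v ∷ σ) (fzero ∷ w) = onesBelow-bound σ w
  onesBelow-bound (v ∷ σ) (fsuc fzero ∷ w) rewrite toℕ<ᵇn v = onesBelow-bound σ w

  biAvoids≡avoidsBelow : {n : ℕ} (σ : Vec (Fin n) n) (w : Vec (Fin 2) n) →
    biAvoids12-01 σ w ≡ avoidsBelow n (Vec.map toℕ σ) w
  biAvoids≡avoidsBelow {n} σ w = begin
    not (contains12-01 σ w)      ≡⟨ cong not (contains12-01≡containsPattern σ w) ⟩
    not contains                  ≡⟨ cong (_∧ not contains) (onesBelow-bound σ w) ⟨
    onesBelow n s w ∧ not contains ≡⟨ avoidsBelow-spec n s w ⟨
    avoidsBelow n s w ∎
    where
    s : Vec ℕ n
    s = Vec.map toℕ σ
    contains : Bool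
    contains = containsPattern s (Vec.map toℕ w)

  labellings : ℕ → Vec ℕ k → ℕ
  labellings {k} t s = sumBy (λ w → ⟦ avoidsBelow t s w ⟧) (allVecs (allFin 2) k)

  avoiders : List ℕ → (k : ℕ) → ℕ → ℕ
  avoiders L k t = sumBy (λ s → ⟦ distinct s ⟧ * labellings t s) (allVecs L k)

  map-toℕ-allFin : (n : ℕ) → map toℕ (allFin n) ≡ upTo n
  map-toℕ-allFin n = trans (List.map-tabulate (λ i → i) toℕ) (tabulate-toℕ n (λ i → i))
    where
    tabulate-toℕ : (n : ℕ) (f : ℕ → ℕ) → tabulate {n = n} (f ∘ toℕ) ≡ applyUpTo f n
    tabulate-toℕ zero f = refl
    tabulate-toℕ (suc n) f = cong (f 0 ∷_) (tabulate-toℕ n (f ∘ suc))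

  A≡avoiders : (n : ℕ) → A n ≡ avoiders (upTo n) n n
  A≡avoiders n = begin
    A n
      ≡⟨ length-filter≡sumBy biAvoids (wreath n) ⟩
    sumBy (⟦_⟧ ∘ biAvoids) (wreath n)
      ≡⟨ sumBy-concatMap _ _ (filter (λ σ → isPerm σ ≟ true) σs) ⟩
    sumBy (λ σ → sumBy (⟦_⟧ ∘ biAvoids) (map (σ ,_) ws)) (filter (λ σ → isPerm σ ≟ true) σs)
      ≡⟨ sumBy-filter isPerm _ σs ⟩
    sumBy (λ σ → ⟦ isPerm σ ⟧ * sumBy (⟦_⟧ ∘ biAvoids) (map (σ ,_) ws)) σs
      ≡⟨ sumBy-cong σs per-σ ⟩
    sumBy (F ∘ Vec.map toℕ) σs
      ≡⟨ sumBy-allVecs-map toℕ (allFin n) n F ⟨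
    sumBy F (allVecs (map toℕ (allFin n)) n)
      ≡⟨ cong (λ L → sumBy F (allVecs L n)) (map-toℕ-allFin n) ⟩
    avoiders (upTo n) n n ∎
    where
    σs : List (Vec (Fin n) n)
    σs = allVecs (allFin n) n
    ws : List (Vec (Fin 2) n)
    ws = allVecs (allFin 2) n
    biAvoids : Vec (Fin n) n × Vec (Fin 2) n → Bool
    biAvoids p = biAvoids12-01 (proj₁ p) (proj₂ p)
    F : Vec ℕ n → ℕ
    F s = ⟦ distinct s ⟧ * labellings n s
    per-σ : ∀ σ → ⟦ isPerm σ ⟧ * sumBy (⟦_⟧ ∘ biAvoids) (map (σ ,_) ws) ≡ F (Vec.map toℕ σ)
    per-σ σ = cong₂ _*_ (cong ⟦_⟧ (isPerm≡distinct σ))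
                (trans (sumBy-map _ (σ ,_) ws) (sumBy-cong ws (cong ⟦_⟧ ∘ biAvoids≡avoidsBelow σ)))

module Counting where

  open Sums
  open Comparisons
  open Enumeration
  open import Defs using (A; allVecs)
  open import Data.Bool using (Bool; true; false; _∧_; not)
  open import Data.Bool.Properties using (∧-assoc; ∧-comm)
  open import Data.Fin using (Fin) renaming (zero to fzero; suc to fsuc)
  open import Data.List using (List; []; _∷_; map; filterᵇ; length; allFin; upTo; applyUpTo)
  import Data.List.Properties as List
  open import Data.List.Membership.Propositional using (_∈_)
  open import Data.List.Relation.Unary.All using (All; []; _∷_)
  import Data.List.Relation.Unary.All as All
  import Data.List.Relation.Unary.All.Properties as All
  open import Data.List.Relation.Unary.AllPairs using (AllPairs; []; _∷_)
  import Data.List.Relation.Unary.AllPairs.Properties as AllPairs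
  open import Data.List.Relation.Unary.Any using (here; there)
  open import Data.Nat using (ℕ; zero; suc; _+_; _*_; _∸_; _⊓_; _≤_; _<_; z≤n; s≤s; _<ᵇ_; _≡ᵇ_)
  open import Data.Nat.ListAction using (sum)
  open import Data.Nat.Properties
  open import Data.Nat.Solver using (module +-*-Solver)
  open import Data.Sum using (inj₁; inj₂)
  open import Data.Vec using (Vec; []; _∷_)
  open import Function using (_∘_)
  open import Relation.Binary.PropositionalEquality
  open +-*-Solver using (solve; _:+_; _:*_; _:=_)
  open ≡-Reasoning

  private
    variable
      k : ℕ

  Increasing : List ℕ → Set
  Increasing = AllPairs _<_

  delete : ℕ → List ℕ → List ℕ
  delete x = filterᵇ (λ y → not (x ≡ᵇ y))

  sumBy-delete : (x : ℕ) (f : ℕ → ℕ) (L : List ℕ) →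
                 sumBy (λ y → ⟦ not (x ≡ᵇ y) ⟧ * f y) L ≡ sumBy f (delete x L)
  sumBy-delete x f [] = refl
  sumBy-delete x f (y ∷ L) with x ≡ᵇ y
  ... | true = sumBy-delete x f L
  ... | false = cong₂ _+_ (+-identityʳ (f y)) (sumBy-delete x f L)

  delete-min : {x : ℕ} {L : List ℕ} → All (x <_) L → delete x L ≡ L
  delete-min [] = refl
  delete-min {x} (_∷_ {y} x<y x<L) rewrite <⇒≡ᵇ≡false x<y = cong (y ∷_) (delete-min x<L)

  Increasing-delete : (x : ℕ) {L : List ℕ} → Increasing L → Increasing (delete x L)
  Increasing-delete x = AllPairs.filter⁺ _

  length-delete : {x : ℕ} {L : List ℕ} → x ∈ L → Increasing L → suc (length (delete x L)) ≡ length L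
  length-delete {x} (here refl) (x<L ∷ _) rewrite ≡ᵇ-refl x | delete-min x<L = refl
  length-delete {x} (there x∈L) (_∷_ {y} y<L incr) rewrite >⇒≡ᵇ≡false (All.lookup y<L x∈L) =
    cong suc (length-delete x∈L incr)

  rank : List ℕ → ℕ → ℕ
  rank L t = sumBy (λ y → ⟦ y <ᵇ t ⟧) L

  ⟦<ᵇ⟧-monoʳ : (y : ℕ) {a b : ℕ} → a ≤ b → ⟦ y <ᵇ a ⟧ ≤ ⟦ y <ᵇ b ⟧
  ⟦<ᵇ⟧-monoʳ y {a} a≤b with y <ᵇ a in eq
  ... | false = z≤n
  ... | true rewrite <⇒<ᵇ≡true (<-≤-trans (<ᵇ≡true⇒< eq) a≤b) = ≤-refl

  rank-mono : (L : List ℕ) {a b : ℕ} → a ≤ b → rank L a ≤ rank L b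
  rank-mono L a≤b = sumBy-mono L (λ y → ⟦<ᵇ⟧-monoʳ y a≤b)

  rank-strict : {x t : ℕ} (L : List ℕ) → x ∈ L → x < t → rank L x < rank L t
  rank-strict {x} {t} (y ∷ L) (here refl) x<t rewrite ≤⇒>ᵇ≡false (≤-refl {x}) | <⇒<ᵇ≡true x<t =
    s≤s (rank-mono L (<⇒≤ x<t))
  rank-strict {x} {t} (y ∷ L) (there x∈L) x<t =
    +-mono-≤-< (⟦<ᵇ⟧-monoʳ y (<⇒≤ x<t)) (rank-strict L x∈L x<t)

  rank-delete : {x t : ℕ} {L : List ℕ} → x ∈ L → Increasing L → x < t →
                rank (delete x L) t ≡ rank L t ∸ 1
  rank-delete {x} (here refl) (x<L ∷ _) x<t rewrite ≡ᵇ-refl x | delete-min x<L | <⇒<ᵇ≡true x<t = refl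
  rank-delete {x} {t} {y ∷ L} (there x∈L) (y<L ∷ incr) x<t
    rewrite >⇒≡ᵇ≡false (All.lookup y<L x∈L) | rank-delete x∈L incr x<t =
    sym (+-∸-assoc ⟦ y <ᵇ t ⟧ (<-≤-trans (s≤s z≤n) (rank-strict L x∈L x<t)))

  rank-⊓ : (L : List ℕ) (x t : ℕ) → rank L (x ⊓ t) ≡ rank L x ⊓ rank L t
  rank-⊓ L x t with ≤-total x t
  ... | inj₁ x≤t rewrite m≤n⇒m⊓n≡m x≤t = sym (m≤n⇒m⊓n≡m (rank-mono L x≤t))
  ... | inj₂ t≤x rewrite m≥n⇒m⊓n≡n t≤x = sym (m≥n⇒m⊓n≡n (rank-mono L t≤x))

  rank-delete-suc-⊓ : (x t : ℕ) (L : List ℕ) → rank (delete x L) (suc x ⊓ t) ≡ rank L x ⊓ rank L t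
  rank-delete-suc-⊓ x t L = begin
    rank (delete x L) (suc x ⊓ t)                            ≡⟨ sumBy-delete x _ L ⟨
    sumBy (λ y → ⟦ not (x ≡ᵇ y) ⟧ * ⟦ y <ᵇ suc x ⊓ t ⟧) L   ≡⟨ sumBy-cong L pointwise ⟩
    rank L (x ⊓ t)                                           ≡⟨ rank-⊓ L x t ⟩
    rank L x ⊓ rank L t ∎
    where
    pointwise : ∀ y → ⟦ not (x ≡ᵇ y) ⟧ * ⟦ y <ᵇ suc x ⊓ t ⟧ ≡ ⟦ y <ᵇ x ⊓ t ⟧
    pointwise y rewrite <ᵇ-suc-⊓ y x t | <ᵇ-⊓ y x t | <ᵇ-trichotomy x y = begin
      ⟦ a ⟧ * ⟦ c ∧ not b ⟧    ≡⟨ cong (λ z → ⟦ a ⟧ * ⟦ z ⟧) (∧-comm c (not b)) ⟩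
      ⟦ a ⟧ * ⟦ not b ∧ c ⟧    ≡⟨ ⟦⟧-∧ a _ ⟨
      ⟦ a ∧ not b ∧ c ⟧        ≡⟨ cong ⟦_⟧ (∧-assoc a _ _) ⟨
      ⟦ (a ∧ not b) ∧ c ⟧ ∎
      where
      a b c : Bool
      a = not (x ≡ᵇ y)
      b = x <ᵇ y
      c = y <ᵇ t

  <ᵇ-rank : {x : ℕ} (t : ℕ) (L : List ℕ) → x ∈ L → (x <ᵇ t) ≡ (rank L x <ᵇ rank L t)
  <ᵇ-rank {x} t L x∈L with x <ᵇ t in eq
  ... | true = sym (<⇒<ᵇ≡true (rank-strict L x∈L (<ᵇ≡true⇒< {x} {t} eq)))
  ... | false = sym (≤⇒>ᵇ≡false (rank-mono L (<ᵇ≡false⇒≥ {x} {t} eq)))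

  All-≤⇒rank≡0 : {t : ℕ} {L : List ℕ} → All (t ≤_) L → rank L t ≡ 0
  All-≤⇒rank≡0 [] = refl
  All-≤⇒rank≡0 (t≤y ∷ t≤L) rewrite ≤⇒>ᵇ≡false t≤y = All-≤⇒rank≡0 t≤L

  sumBy-rank : (L : List ℕ) → Increasing L → (H : ℕ → ℕ) →
               sumBy (H ∘ rank L) L ≡ sum (applyUpTo H (length L))
  sumBy-rank [] [] H = refl
  sumBy-rank (y ∷ L) (y<L ∷ incr) H =
    cong₂ _+_ (cong H rank-y) (trans (sumBy-cong-All rank-above y<L) (sumBy-rank L incr (H ∘ suc)))
    where
    rank-y : rank (y ∷ L) y ≡ 0
    rank-y rewrite ≤⇒>ᵇ≡false (≤-refl {y}) = All-≤⇒rank≡0 (All.map <⇒≤ y<L)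
    rank-above : ∀ {z} → y < z → H (rank (y ∷ L) z) ≡ H (suc (rank L z))
    rank-above y<z rewrite <⇒<ᵇ≡true y<z = refl

  rank-upTo : (n : ℕ) → rank (upTo n) n ≡ n
  rank-upTo n = begin
    rank (upTo n) n
      ≡⟨ sumBy-cong-All (cong ⟦_⟧ ∘ <⇒<ᵇ≡true) (All.applyUpTo⁺₁ (λ i → i) n (λ i<n → i<n)) ⟩
    sumBy (λ _ → 1) (upTo n)   ≡⟨ sumBy-1 (upTo n) ⟩
    length (upTo n)            ≡⟨ List.length-upTo n ⟩
    n ∎
    where
    sumBy-1 : (xs : List ℕ) → sumBy (λ _ → 1) xs ≡ length xs
    sumBy-1 [] = refl
    sumBy-1 (_ ∷ xs) = cong suc (sumBy-1 xs)

  labellings-∷ : (t x : ℕ) (s : Vec ℕ k) →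
                 labellings t (x ∷ s) ≡ labellings (suc x ⊓ t) s + ⟦ x <ᵇ t ⟧ * labellings t s
  labellings-∷ {k} t x s = begin
    labellings t (x ∷ s)
      ≡⟨ sumBy-concatMap _ (λ b → map (b ∷_) ws) (allFin 2) ⟩
    sumBy count (map (fzero ∷_) ws) + (sumBy count (map (fsuc fzero ∷_) ws) + 0)
      ≡⟨ cong₂ _+_ (sumBy-map count (fzero ∷_) ws)
                   (trans (+-identityʳ _) (sumBy-map count (fsuc fzero ∷_) ws)) ⟩
    labellings (suc x ⊓ t) s + sumBy (λ w → ⟦ (x <ᵇ t) ∧ avoidsBelow t s w ⟧) ws
      ≡⟨ cong (labellings (suc x ⊓ t) s +_)
           (trans (sumBy-cong ws (λ w → ⟦⟧-∧ (x <ᵇ t) (avoidsBelow t s w)))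
                  (sumBy-*ˡ ⟦ x <ᵇ t ⟧ _ ws)) ⟩
    labellings (suc x ⊓ t) s + ⟦ x <ᵇ t ⟧ * labellings t s ∎
    where
    ws : List (Vec (Fin 2) k)
    ws = allVecs (allFin 2) k
    count : Vec (Fin 2) (suc k) → ℕ
    count w = ⟦ avoidsBelow t (x ∷ s) w ⟧

  sumBy-allVecs-∉ᵇ : (x : ℕ) (L : List ℕ) (k : ℕ) (G : Vec ℕ k → ℕ) →
    sumBy (λ s → ⟦ x ∉ᵇ s ⟧ * G s) (allVecs L k) ≡ sumBy G (allVecs (delete x L) k)
  sumBy-allVecs-∉ᵇ x L zero G = cong (_+ 0) (*-identityˡ (G []))
  sumBy-allVecs-∉ᵇ x L (suc k) G = begin
    sumBy (λ s → ⟦ x ∉ᵇ s ⟧ * G s) (allVecs L (suc k))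
      ≡⟨ sumBy-concatMap _ _ L ⟩
    sumBy (λ y → sumBy (λ s → ⟦ x ∉ᵇ s ⟧ * G s) (map (y ∷_) (allVecs L k))) L
      ≡⟨ sumBy-cong L (λ y → trans (sumBy-map _ (y ∷_) (allVecs L k)) (first-letter y)) ⟩
    sumBy (λ y → ⟦ not (x ≡ᵇ y) ⟧ * sumBy (λ s → ⟦ x ∉ᵇ s ⟧ * G (y ∷ s)) (allVecs L k)) L
      ≡⟨ sumBy-cong L (λ y → cong (⟦ not (x ≡ᵇ y) ⟧ *_) (sumBy-allVecs-∉ᵇ x L k (G ∘ (y ∷_)))) ⟩
    sumBy (λ y → ⟦ not (x ≡ᵇ y) ⟧ * sumBy (G ∘ (y ∷_)) (allVecs (delete x L) k)) L
      ≡⟨ sumBy-delete x _ L ⟩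
    sumBy (λ y → sumBy (G ∘ (y ∷_)) (allVecs (delete x L) k)) (delete x L)
      ≡⟨ sumBy-cong (delete x L) (λ y → sumBy-map G (y ∷_) (allVecs (delete x L) k)) ⟨
    sumBy (λ y → sumBy G (map (y ∷_) (allVecs (delete x L) k))) (delete x L)
      ≡⟨ sumBy-concatMap _ _ (delete x L) ⟨
    sumBy G (allVecs (delete x L) (suc k)) ∎
    where
    first-letter : ∀ y → sumBy (λ s → ⟦ not (x ≡ᵇ y) ∧ (x ∉ᵇ s) ⟧ * G (y ∷ s)) (allVecs L k)
                       ≡ ⟦ not (x ≡ᵇ y) ⟧ * sumBy (λ s → ⟦ x ∉ᵇ s ⟧ * G (y ∷ s)) (allVecs L k)
    first-letter y = trans
      (sumBy-cong (allVecs L k) (λ s → trans (cong (_* G (y ∷ s)) (⟦⟧-∧ (not (x ≡ᵇ y)) (x ∉ᵇ s)))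
                                             (*-assoc ⟦ not (x ≡ᵇ y) ⟧ ⟦ x ∉ᵇ s ⟧ (G (y ∷ s)))))
      (sumBy-*ˡ ⟦ not (x ≡ᵇ y) ⟧ _ (allVecs L k))

  byFirstLetter : List ℕ → ℕ → ℕ → ℕ → ℕ
  byFirstLetter L k t x = avoiders (delete x L) k (suc x ⊓ t) + ⟦ x <ᵇ t ⟧ * avoiders (delete x L) k t

  avoiders-suc : (L : List ℕ) (k t : ℕ) → avoiders L (suc k) t ≡ sumBy (byFirstLetter L k t) L
  avoiders-suc L k t = begin
    avoiders L (suc k) t
      ≡⟨ sumBy-concatMap _ _ L ⟩
    sumBy (λ x → sumBy F (map (x ∷_) (allVecs L k))) L
      ≡⟨ sumBy-cong L (λ x → trans (sumBy-map F (x ∷_) (allVecs L k))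
                                   (sumBy-cong (allVecs L k) (split x))) ⟩
    sumBy (λ x → sumBy (λ s → ⟦ x ∉ᵇ s ⟧ * G x s) (allVecs L k)) L
      ≡⟨ sumBy-cong L (λ x → sumBy-allVecs-∉ᵇ x L k (G x)) ⟩
    sumBy (λ x → sumBy (G x) (allVecs (delete x L) k)) L
      ≡⟨ sumBy-cong L (λ x → trans (sumBy-+ _ _ (allVecs (delete x L) k))
                                   (cong (avoiders (delete x L) k (suc x ⊓ t) +_)
                                         (sumBy-*ˡ ⟦ x <ᵇ t ⟧ _ (allVecs (delete x L) k)))) ⟩
    sumBy (byFirstLetter L k t) L ∎
    where
    F : Vec ℕ (suc k) → ℕ
    F s = ⟦ distinct s ⟧ * labellings t s
    G : ℕ → Vec ℕ k → ℕ
    G x s = ⟦ distinct s ⟧ * labellings (suc x ⊓ t) s + ⟦ x <ᵇ t ⟧ * (⟦ distinct s ⟧ * labellings t s)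
    split : ∀ x s → F (x ∷ s) ≡ ⟦ x ∉ᵇ s ⟧ * G x s
    split x s rewrite ⟦⟧-∧ (x ∉ᵇ s) (distinct s) | labellings-∷ t x s =
      solve 5 (λ a b c d e → (a :* b) :* (c :+ d :* e) := a :* (b :* c :+ d :* (b :* e))) refl
        ⟦ x ∉ᵇ s ⟧ ⟦ distinct s ⟧ (labellings (suc x ⊓ t) s) ⟦ x <ᵇ t ⟧ (labellings t s)

  -- The first letter, of rank r, labelled 0 leaves a bound of rank min(r, t) among the remaining
  -- letters; labelled 1, which needs r < t, it leaves the bound of rank t − 1.
  avoidersByRank : ℕ → ℕ → ℕ
  avoidersByRank zero t = 1
  avoidersByRank (suc k) t =
    sum (applyUpTo (λ r → avoidersByRank k (r ⊓ t) + ⟦ r <ᵇ t ⟧ * avoidersByRank k (t ∸ 1)) (suc k))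

  avoiders≡avoidersByRank : (k : ℕ) (L : List ℕ) → Increasing L → length L ≡ k → (t : ℕ) →
                            avoiders L k t ≡ avoidersByRank k (rank L t)
  avoiders≡avoidersByRank zero L incr |L|≡k t = refl
  avoiders≡avoidersByRank (suc k) L incr |L|≡k t = begin
    avoiders L (suc k) t                ≡⟨ avoiders-suc L k t ⟩
    sumBy (byFirstLetter L k t) L       ≡⟨ sumBy-cong-∈ L by-rank ⟩
    sumBy (H ∘ rank L) L                ≡⟨ sumBy-rank L incr H ⟩
    sum (applyUpTo H (length L))        ≡⟨ cong (sum ∘ applyUpTo H) |L|≡k ⟩
    avoidersByRank (suc k) (rank L t) ∎
    where
    r : ℕ
    r = rank L t
    H : ℕ → ℕ
    H q = avoidersByRank k (q ⊓ r) + ⟦ q <ᵇ r ⟧ * avoidersByRank k (r ∸ 1)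
    by-rank : ∀ {x} → x ∈ L → byFirstLetter L k t x ≡ H (rank L x)
    by-rank {x} x∈L = cong₂ _+_ below-x at-x
      where
      IH : ∀ t' → avoiders (delete x L) k t' ≡ avoidersByRank k (rank (delete x L) t')
      IH = avoiders≡avoidersByRank k (delete x L) (Increasing-delete x incr)
             (suc-injective (trans (length-delete x∈L incr) |L|≡k))
      below-x : avoiders (delete x L) k (suc x ⊓ t) ≡ avoidersByRank k (rank L x ⊓ r)
      below-x = trans (IH (suc x ⊓ t)) (cong (avoidersByRank k) (rank-delete-suc-⊓ x t L))
      at-x : ⟦ x <ᵇ t ⟧ * avoiders (delete x L) k t ≡ ⟦ rank L x <ᵇ r ⟧ * avoidersByRank k (r ∸ 1)
      at-x with x <ᵇ t in eq
      ... | true = cong₂ _*_ (cong ⟦_⟧ (trans (sym eq) (<ᵇ-rank t L x∈L)))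
                             (trans (IH t) (cong (avoidersByRank k)
                                                 (rank-delete x∈L incr (<ᵇ≡true⇒< {x} {t} eq))))
      ... | false = cong (λ b → ⟦ b ⟧ * avoidersByRank k (r ∸ 1)) (trans (sym eq) (<ᵇ-rank t L x∈L))

  A≡avoidersByRank : (n : ℕ) → A n ≡ avoidersByRank n n
  A≡avoidersByRank n = begin
    A n                                  ≡⟨ A≡avoiders n ⟩
    avoiders (upTo n) n n                ≡⟨ avoiders≡avoidersByRank n (upTo n) upTo-incr (List.length-upTo n) n ⟩
    avoidersByRank n (rank (upTo n) n)   ≡⟨ cong (avoidersByRank n) (rank-upTo n) ⟩
    avoidersByRank n n ∎
    where
    upTo-incr : Increasing (upTo n)
    upTo-incr = AllPairs.applyUpTo⁺₁ (λ i → i) n (λ i<j _ → i<j)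

module Rationals where

  import Data.Integer as ℤ
  import Data.Integer.Properties as ℤ
  open import Data.Nat using (ℕ; zero; suc; NonZero; _!) renaming (_+_ to _+ℕ_; _*_ to _*ℕ_)
  open import Data.Nat.Properties using (*-identityˡ; *-identityʳ; +-identityʳ; _!≢0)
  open import Data.Rational using (ℚ; _/_; _+_; _*_; 1ℚ; toℚᵘ)
  open import Data.Rational.Properties as ℚ
    using (toℚᵘ-injective; toℚᵘ-fromℚᵘ; toℚᵘ-homo-+; toℚᵘ-homo-*)
  open import Data.Rational.Solver using (module +-*-Solver)
  open import Data.Rational.Unnormalised as ℚᵘ using (mkℚᵘ; *≡*) renaming (_≃_ to _≃ᵘ_)
  import Data.Rational.Unnormalised.Properties as ℚᵘ
  open import Relation.Binary.PropositionalEquality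
  open +-*-Solver using (solve; con; _:+_; _:*_; _:=_)

  ι : ℕ → ℚ
  ι n = ℤ.+ n / 1

  private
    toℚᵘ-/ : (a d : ℕ) → toℚᵘ (ℤ.+ a / suc d) ≃ᵘ mkℚᵘ (ℤ.+ a) d
    toℚᵘ-/ a d = toℚᵘ-fromℚᵘ (mkℚᵘ (ℤ.+ a) d)

    mkℚᵘ-≃ : {a b c d : ℕ} → a *ℕ suc d ≡ c *ℕ suc b → mkℚᵘ (ℤ.+ a) b ≃ᵘ mkℚᵘ (ℤ.+ c) d
    mkℚᵘ-≃ {a} {b} {c} {d} eq =
      *≡* (trans (sym (ℤ.pos-* a (suc d))) (trans (cong ℤ.+_ eq) (ℤ.pos-* c (suc b))))

    mkℚᵘ-* : (a b c d : ℕ) →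
             mkℚᵘ (ℤ.+ a) b ℚᵘ.* mkℚᵘ (ℤ.+ c) d ≃ᵘ mkℚᵘ (ℤ.+ (a *ℕ c)) (d +ℕ b *ℕ suc d)
    mkℚᵘ-* a b c d = ℚᵘ.≃-reflexive (cong (λ z → mkℚᵘ z (d +ℕ b *ℕ suc d)) (sym (ℤ.pos-* a c)))

  ι-suc : (n : ℕ) → ι (suc n) ≡ 1ℚ + ι n
  ι-suc n = toℚᵘ-injective (begin
    toℚᵘ (ι (suc n))                      ≈⟨ toℚᵘ-/ (suc n) 0 ⟩
    mkℚᵘ (ℤ.+ suc n) 0                    ≈⟨ *≡* (cong (ℤ._* ℤ.+ 1) numerator) ⟩
    mkℚᵘ (ℤ.+ 1) 0 ℚᵘ.+ mkℚᵘ (ℤ.+ n) 0    ≈⟨ ℚᵘ.+-cong (toℚᵘ-/ 1 0) (toℚᵘ-/ n 0) ⟨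
    toℚᵘ 1ℚ ℚᵘ.+ toℚᵘ (ι n)               ≈⟨ toℚᵘ-homo-+ 1ℚ (ι n) ⟨
    toℚᵘ (1ℚ + ι n) ∎)
    where
    open ℚᵘ.≃-Reasoning
    numerator : ℤ.+ suc n ≡ ℤ.+ 1 ℤ.+ ℤ.+ n ℤ.* ℤ.+ 1
    numerator = trans (ℤ.pos-+ 1 n) (cong (ℤ._+_ (ℤ.+ 1)) (sym (ℤ.*-identityʳ (ℤ.+ n))))

  /≡ι*1/ : (a d : ℕ) .{{_ : NonZero d}} → ℤ.+ a / d ≡ ι a * (ℤ.+ 1 / d)
  /≡ι*1/ a (suc d) = toℚᵘ-injective (begin
    toℚᵘ (ℤ.+ a / suc d)                   ≈⟨ toℚᵘ-/ a d ⟩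
    mkℚᵘ (ℤ.+ a) d                         ≈⟨ mkℚᵘ-≃ cross ⟩
    mkℚᵘ (ℤ.+ (a *ℕ 1)) (d +ℕ 0)           ≈⟨ mkℚᵘ-* a 0 1 d ⟨
    mkℚᵘ (ℤ.+ a) 0 ℚᵘ.* mkℚᵘ (ℤ.+ 1) d     ≈⟨ ℚᵘ.*-cong (toℚᵘ-/ a 0) (toℚᵘ-/ 1 d) ⟨
    toℚᵘ (ι a) ℚᵘ.* toℚᵘ (ℤ.+ 1 / suc d)   ≈⟨ toℚᵘ-homo-* (ι a) (ℤ.+ 1 / suc d) ⟨
    toℚᵘ (ι a * (ℤ.+ 1 / suc d)) ∎)
    where
    open ℚᵘ.≃-Reasoning
    cross : a *ℕ suc (d +ℕ 0) ≡ a *ℕ 1 *ℕ suc d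
    cross = cong₂ _*ℕ_ (sym (*-identityʳ a)) (cong suc (+-identityʳ d))

  ι*1/*≡1/ : (n d : ℕ) .{{_ : NonZero n}} .{{_ : NonZero d}} .{{_ : NonZero (n *ℕ d)}} →
             ι n * (ℤ.+ 1 / (n *ℕ d)) ≡ ℤ.+ 1 / d
  ι*1/*≡1/ (suc n) (suc d) = toℚᵘ-injective (begin
    toℚᵘ (ι (suc n) * (ℤ.+ 1 / (suc n *ℕ suc d)))          ≈⟨ toℚᵘ-homo-* (ι (suc n)) _ ⟩
    toℚᵘ (ι (suc n)) ℚᵘ.* toℚᵘ (ℤ.+ 1 / (suc n *ℕ suc d))
                                                           ≈⟨ ℚᵘ.*-cong (toℚᵘ-/ (suc n) 0) (toℚᵘ-/ 1 m) ⟩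
    mkℚᵘ (ℤ.+ suc n) 0 ℚᵘ.* mkℚᵘ (ℤ.+ 1) m                 ≈⟨ mkℚᵘ-* (suc n) 0 1 m ⟩
    mkℚᵘ (ℤ.+ (suc n *ℕ 1)) (m +ℕ 0)                       ≈⟨ mkℚᵘ-≃ cross ⟩
    mkℚᵘ (ℤ.+ 1) d                                         ≈⟨ toℚᵘ-/ 1 d ⟨
    toℚᵘ (ℤ.+ 1 / suc d) ∎)
    where
    open ℚᵘ.≃-Reasoning
    m : ℕ
    m = d +ℕ n *ℕ suc d
    cross : suc n *ℕ 1 *ℕ suc d ≡ 1 *ℕ suc (m +ℕ 0)
    cross = trans (cong (_*ℕ suc d) (*-identityʳ (suc n)))
                  (sym (trans (*-identityˡ _) (cong suc (+-identityʳ m))))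

  ι-+ : (m n : ℕ) → ι (m +ℕ n) ≡ ι m + ι n
  ι-+ zero n = sym (ℚ.+-identityˡ (ι n))
  ι-+ (suc m) n = begin
    ι (suc (m +ℕ n))       ≡⟨ ι-suc (m +ℕ n) ⟩
    1ℚ + ι (m +ℕ n)        ≡⟨ cong (1ℚ +_) (ι-+ m n) ⟩
    1ℚ + (ι m + ι n)       ≡⟨ ℚ.+-assoc 1ℚ (ι m) (ι n) ⟨
    (1ℚ + ι m) + ι n       ≡⟨ cong (_+ ι n) (ι-suc m) ⟨
    ι (suc m) + ι n ∎
    where open ≡-Reasoning

  ι-* : (m n : ℕ) → ι (m *ℕ n) ≡ ι m * ι n
  ι-* zero n = sym (ℚ.*-zeroˡ (ι n))
  ι-* (suc m) n = begin
    ι (n +ℕ m *ℕ n)        ≡⟨ ι-+ n (m *ℕ n) ⟩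
    ι n + ι (m *ℕ n)       ≡⟨ cong (ι n +_) (ι-* m n) ⟩
    ι n + ι m * ι n        ≡⟨ solve 2 (λ a b → b :+ a :* b := (con 1ℚ :+ a) :* b) refl (ι m) (ι n) ⟩
    (1ℚ + ι m) * ι n       ≡⟨ cong (_* ι n) (ι-suc m) ⟨
    ι (suc m) * ι n ∎
    where open ≡-Reasoning

  invFact : ℕ → ℚ
  invFact n = (ℤ.+ 1 / n !) {{n !≢0}}

  ι-suc*invFact-suc : (m : ℕ) → ι (suc m) * invFact (suc m) ≡ invFact m
  ι-suc*invFact-suc m = ι*1/*≡1/ (suc m) (m !) {{_}} {{m !≢0}} {{suc m !≢0}}

  ι!*invFact : (n : ℕ) → ι (n !) * invFact n ≡ 1ℚ
  ι!*invFact zero = refl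
  ι!*invFact (suc n) = begin
    ι (suc n *ℕ n !) * invFact (suc n)          ≡⟨ cong (_* invFact (suc n)) (ι-* (suc n) (n !)) ⟩
    ι (suc n) * ι (n !) * invFact (suc n)
      ≡⟨ solve 3 (λ a b c → a :* b :* c := b :* (a :* c)) refl (ι (suc n)) (ι (n !)) (invFact (suc n)) ⟩
    ι (n !) * (ι (suc n) * invFact (suc n))     ≡⟨ cong (ι (n !) *_) (ι-suc*invFact-suc n) ⟩
    ι (n !) * invFact n                         ≡⟨ ι!*invFact n ⟩
    1ℚ ∎
    where open ≡-Reasoning

  ι!*-*invFact : (n : ℕ) (x : ℚ) → ι (n !) * x * invFact n ≡ x
  ι!*-*invFact n x = begin
    ι (n !) * x * invFact n
      ≡⟨ solve 3 (λ a x b → a :* x :* b := (a :* b) :* x) refl (ι (n !)) x (invFact n) ⟩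
    ι (n !) * invFact n * x      ≡⟨ cong (_* x) (ι!*invFact n) ⟩
    1ℚ * x                       ≡⟨ ℚ.*-identityˡ x ⟩
    x ∎
    where open ≡-Reasoning

module Coefficients where

  open Comparisons using (<⇒<ᵇ≡true; ≤⇒>ᵇ≡false)
  open Sums using (⟦_⟧)
  open Counting using (avoidersByRank)
  open Rationals
  open import Defs using (sumTo; pow; xOver1-x; expS; geom; _⊛_; egf)
  open import Data.List using (foldr; applyUpTo)
  open import Data.Nat using (ℕ; zero; suc; _!; _∸_; _⊓_; _≤_; _<_; z≤n; s≤s; _<ᵇ_)
    renaming (_+_ to _+ℕ_; _*_ to _*ℕ_)
  open import Data.Nat.ListAction using (sum)
  import Data.Nat.Properties as ℕ
  open import Data.Rational using (ℚ; _+_; _*_; 0ℚ; 1ℚ)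
  import Data.Rational.Properties as ℚ
  open import Data.Rational.Solver using (module +-*-Solver)
  open import Data.Sum using (inj₁; inj₂)
  open import Function using (_∘_)
  open import Relation.Binary.PropositionalEquality
  open +-*-Solver using (solve; con; _:+_; _:*_; _:=_)
  open ≡-Reasoning

  egf≡ι*invFact : (a : ℕ → ℕ) (n : ℕ) → egf a n ≡ ι (a n) * invFact n
  egf≡ι*invFact a n = /≡ι*1/ (a n) (n !) {{n ℕ.!≢0}}

  ∑< : ℕ → (ℕ → ℚ) → ℚ
  ∑< zero f = 0ℚ
  ∑< (suc m) f = f 0 + ∑< m (f ∘ suc)

  syntax ∑< m (λ r → e) = ∑[ r < m ] e

  ∑-cong< : (m : ℕ) {f g : ℕ → ℚ} → (∀ {r} → r < m → f r ≡ g r) → ∑< m f ≡ ∑< m g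
  ∑-cong< zero f≗g = refl
  ∑-cong< (suc m) f≗g = cong₂ _+_ (f≗g (s≤s z≤n)) (∑-cong< m (f≗g ∘ s≤s))

  ∑-cong : (m : ℕ) {f g : ℕ → ℚ} → (∀ r → f r ≡ g r) → ∑< m f ≡ ∑< m g
  ∑-cong m f≗g = ∑-cong< m (λ {r} _ → f≗g r)

  ∑-distrib-+ : (m : ℕ) (f g : ℕ → ℚ) → ∑[ r < m ] (f r + g r) ≡ ∑< m f + ∑< m g
  ∑-distrib-+ zero f g = refl
  ∑-distrib-+ (suc m) f g rewrite ∑-distrib-+ m (f ∘ suc) (g ∘ suc) =
    solve 4 (λ a b x y → (a :+ b) :+ (x :+ y) := (a :+ x) :+ (b :+ y)) refl
      (f 0) (g 0) (∑< m (f ∘ suc)) (∑< m (g ∘ suc))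

  ∑-*ˡ : (m : ℕ) (a : ℚ) (f : ℕ → ℚ) → ∑[ r < m ] (a * f r) ≡ a * ∑< m f
  ∑-*ˡ zero a f = sym (ℚ.*-zeroʳ a)
  ∑-*ˡ (suc m) a f rewrite ∑-*ˡ m a (f ∘ suc) = sym (ℚ.*-distribˡ-+ a (f 0) _)

  ∑-const : (m : ℕ) (a : ℚ) → ∑[ r < m ] a ≡ ι m * a
  ∑-const zero a = sym (ℚ.*-zeroˡ a)
  ∑-const (suc m) a rewrite ∑-const m a | ι-suc m =
    solve 2 (λ a x → a :+ x :* a := (con 1ℚ :+ x) :* a) refl a (ι m)

  ∑-zero : (m : ℕ) (f : ℕ → ℚ) → (∀ {r} → r < m → f r ≡ 0ℚ) → ∑< m f ≡ 0ℚ
  ∑-zero m f f≡0 = trans (∑-cong< m f≡0) (∑-const-0 m)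
    where
    ∑-const-0 : (m : ℕ) → ∑[ r < m ] 0ℚ ≡ 0ℚ
    ∑-const-0 m = trans (∑-const m 0ℚ) (ℚ.*-zeroʳ (ι m))

  ∑-suc : (m : ℕ) (f : ℕ → ℚ) → ∑< (suc m) f ≡ ∑< m f + f m
  ∑-suc zero f = trans (ℚ.+-identityʳ (f 0)) (sym (ℚ.+-identityˡ (f 0)))
  ∑-suc (suc m) f = trans (cong (f 0 +_) (∑-suc m (f ∘ suc))) (sym (ℚ.+-assoc (f 0) _ _))

  ∑-comm : (a b : ℕ) (f : ℕ → ℕ → ℚ) → ∑[ i < a ] ∑[ j < b ] f i j ≡ ∑[ j < b ] ∑[ i < a ] f i j
  ∑-comm zero b f = sym (∑-zero b _ (λ _ → refl))
  ∑-comm (suc a) b f = begin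
    ∑< b (f 0) + ∑[ i < a ] ∑[ j < b ] f (suc i) j   ≡⟨ cong (∑< b (f 0) +_) (∑-comm a b (f ∘ suc)) ⟩
    ∑< b (f 0) + ∑[ j < b ] ∑[ i < a ] f (suc i) j   ≡⟨ ∑-distrib-+ b (f 0) _ ⟨
    ∑[ j < b ] ∑[ i < suc a ] f i j ∎

  ∑-reverse : (n : ℕ) (f : ℕ → ℚ) → ∑[ i < suc n ] f (n ∸ i) ≡ ∑< (suc n) f
  ∑-reverse zero f = refl
  ∑-reverse (suc n) f = begin
    f (suc n) + ∑[ i < suc n ] f (n ∸ i)   ≡⟨ cong (f (suc n) +_) (∑-reverse n f) ⟩
    f (suc n) + ∑< (suc n) f               ≡⟨ ℚ.+-comm (f (suc n)) _ ⟩
    ∑< (suc n) f + f (suc n)               ≡⟨ ∑-suc (suc n) f ⟨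
    ∑< (suc (suc n)) f ∎

  ∑-vanishing-tail : (m d : ℕ) (f : ℕ → ℚ) → (∀ {k} → m ≤ k → f k ≡ 0ℚ) →
                     ∑< (m +ℕ d) f ≡ ∑< m f
  ∑-vanishing-tail m zero f f≡0 = cong (λ x → ∑< x f) (ℕ.+-identityʳ m)
  ∑-vanishing-tail m (suc d) f f≡0 = begin
    ∑< (m +ℕ suc d) f            ≡⟨ cong (λ x → ∑< x f) (ℕ.+-suc m d) ⟩
    ∑< (suc (m +ℕ d)) f          ≡⟨ ∑-suc (m +ℕ d) f ⟩
    ∑< (m +ℕ d) f + f (m +ℕ d)   ≡⟨ cong₂ _+_ (∑-vanishing-tail m d f f≡0) (f≡0 (ℕ.m≤m+n m d)) ⟩
    ∑< m f + 0ℚ                  ≡⟨ ℚ.+-identityʳ _ ⟩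
    ∑< m f ∎

  ι-sum : (m : ℕ) (f : ℕ → ℕ) → ι (sum (applyUpTo f m)) ≡ ∑[ r < m ] ι (f r)
  ι-sum zero f = refl
  ι-sum (suc m) f = trans (ι-+ (f 0) _) (cong (ι (f 0) +_) (ι-sum m (f ∘ suc)))

  sumTo≡∑ : (n : ℕ) (f : ℕ → ℚ) → sumTo n f ≡ ∑< (suc n) f
  sumTo≡∑ n f = foldr-applyUpTo (λ r → r) (suc n)
    where
    foldr-applyUpTo : (h : ℕ → ℕ) (m : ℕ) →
      foldr (λ i acc → f i + acc) 0ℚ (applyUpTo h m) ≡ ∑[ r < m ] f (h r)
    foldr-applyUpTo h zero = refl
    foldr-applyUpTo h (suc m) = cong (f (h 0) +_) (foldr-applyUpTo (h ∘ suc) m)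

  -- S m n = Σⱼ C(n, j) / (m + j)!
  S : ℕ → ℕ → ℚ
  S m zero = invFact m
  S m (suc n) = S m n + S (suc m) n

  -- At m = 0 this is S 0 n = (n + 2) S 2 n, the step needed in ∑-S₀.
  S-lower : (n m : ℕ) → S m n ≡ ι (suc (suc (n +ℕ m))) * S (suc (suc m)) n + ι m * S (suc m) n
  S-lower zero m = begin
    invFact m                                  ≡⟨ ι-suc*invFact-suc m ⟨
    ι (suc m) * invFact (suc m)                ≡⟨ cong (ι (suc m) *_) (ι-suc*invFact-suc (suc m)) ⟨
    ι (suc m) * (ι (suc (suc m)) * c₂)         ≡⟨ cong (λ x → x * (ι (suc (suc m)) * c₂)) (ι-suc m) ⟩
    (1ℚ + ι m) * (ι (suc (suc m)) * c₂)
      ≡⟨ solve 3 (λ x y c → (con 1ℚ :+ x) :* (y :* c) := y :* c :+ x :* (y :* c)) refl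
           (ι m) (ι (suc (suc m))) c₂ ⟩
    ι (suc (suc m)) * c₂ + ι m * (ι (suc (suc m)) * c₂)
      ≡⟨ cong (λ x → ι (suc (suc m)) * c₂ + ι m * x) (ι-suc*invFact-suc (suc m)) ⟩
    ι (suc (suc m)) * c₂ + ι m * invFact (suc m) ∎
    where
    c₂ : ℚ
    c₂ = invFact (suc (suc m))
  S-lower (suc n) m = begin
    S m n + S (suc m) n                      ≡⟨ cong₂ _+_ (S-lower n m) (S-lower n (suc m)) ⟩
    (ι (suc (suc (n +ℕ m))) * Q + ι m * P) + (ι (suc (suc (n +ℕ suc m))) * R + ι (suc m) * Q)
                                             ≡⟨ regroup ⟩
    ι (suc (suc (suc (n +ℕ m)))) * (Q + R) + ι m * (P + Q) ∎
    where
    P Q R : ℚ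
    P = S (suc m) n
    Q = S (suc (suc m)) n
    R = S (suc (suc (suc m))) n
    regroup : (ι (suc (suc (n +ℕ m))) * Q + ι m * P) + (ι (suc (suc (n +ℕ suc m))) * R + ι (suc m) * Q) ≡
              ι (suc (suc (suc (n +ℕ m)))) * (Q + R) + ι m * (P + Q)
    regroup rewrite ℕ.+-suc n m | ι-suc (suc (suc (n +ℕ m))) | ι-suc (suc (n +ℕ m)) | ι-suc (n +ℕ m)
                  | ι-suc m | ι-+ n m =
      solve 5 (λ a b P Q R →
        ((con 1ℚ :+ (con 1ℚ :+ (a :+ b))) :* Q :+ b :* P)
          :+ ((con 1ℚ :+ (con 1ℚ :+ (con 1ℚ :+ (a :+ b)))) :* R :+ (con 1ℚ :+ b) :* Q)
        := (con 1ℚ :+ (con 1ℚ :+ (con 1ℚ :+ (a :+ b)))) :* (Q :+ R) :+ b :* (P :+ Q))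
        refl (ι n) (ι m) P Q R

  ∑-S₀ : (k : ℕ) → ∑< (suc k) (S 0) ≡ ι (suc k) * S 1 k
  ∑-S₀ zero = refl
  ∑-S₀ (suc k) = begin
    ∑< (suc (suc k)) (S 0)               ≡⟨ ∑-suc (suc k) (S 0) ⟩
    ∑< (suc k) (S 0) + (S 0 k + S 1 k)   ≡⟨ cong₂ (λ x y → x + (y + S 1 k)) (∑-S₀ k) (S-lower k 0) ⟩
    ι (suc k) * S 1 k + ((ι (suc (suc (k +ℕ 0))) * S 2 k + 0ℚ * S 1 k) + S 1 k)
                                         ≡⟨ regroup ⟩
    ι (suc (suc k)) * (S 1 k + S 2 k) ∎
    where
    regroup : ι (suc k) * S 1 k + ((ι (suc (suc (k +ℕ 0))) * S 2 k + 0ℚ * S 1 k) + S 1 k) ≡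
              ι (suc (suc k)) * (S 1 k + S 2 k)
    regroup rewrite ℕ.+-identityʳ k | ι-suc (suc k) | ι-suc k =
      solve 3 (λ a P Q → (con 1ℚ :+ a) :* P :+ (((con 1ℚ :+ (con 1ℚ :+ a)) :* Q :+ con 0ℚ :* P) :+ P)
        := (con 1ℚ :+ (con 1ℚ :+ a)) :* (P :+ Q)) refl (ι k) (S 1 k) (S 2 k)

  -- The summand of avoidersByRank (k + 1) t, with each avoidersByRank k t′ replaced by S 0 t′.
  recurrenceTerm : ℕ → ℕ → ℚ
  recurrenceTerm t r = S 0 (r ⊓ t) + ι ⟦ r <ᵇ t ⟧ * S 0 (t ∸ 1)

  recurrenceSum : ℕ → ℕ → ℚ
  recurrenceSum k t = ∑< (suc k) (recurrenceTerm t)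

  recurrenceSum-top : (k : ℕ) → recurrenceSum k (suc k) ≡ ι (suc k) * S 0 (suc k)
  recurrenceSum-top k = begin
    recurrenceSum k (suc k)                             ≡⟨ ∑-cong< (suc k) below-top ⟩
    ∑[ r < suc k ] (S 0 r + S 0 k)                ≡⟨ ∑-distrib-+ (suc k) (S 0) (λ _ → S 0 k) ⟩
    ∑< (suc k) (S 0) + ∑[ r < suc k ] S 0 k       ≡⟨ cong₂ _+_ (∑-S₀ k) (∑-const (suc k) (S 0 k)) ⟩
    ι (suc k) * S 1 k + ι (suc k) * S 0 k         ≡⟨ ℚ.*-distribˡ-+ (ι (suc k)) (S 1 k) (S 0 k) ⟨
    ι (suc k) * (S 1 k + S 0 k)                   ≡⟨ cong (ι (suc k) *_) (ℚ.+-comm (S 1 k) (S 0 k)) ⟩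
    ι (suc k) * S 0 (suc k) ∎
    where
    below-top : ∀ {r} → r < suc k → S 0 (r ⊓ suc k) + ι ⟦ r <ᵇ suc k ⟧ * S 0 k ≡ S 0 r + S 0 k
    below-top {r} r<sk rewrite ℕ.m≤n⇒m⊓n≡m (ℕ.<⇒≤ r<sk) | <⇒<ᵇ≡true r<sk =
      cong (S 0 r +_) (ℚ.*-identityˡ (S 0 k))

  recurrenceSum≡ : (k t : ℕ) → t ≤ suc k → recurrenceSum k t ≡ ι (suc k) * S 0 t
  recurrenceSum≡ k t t≤sk with ℕ.m≤n⇒m<n∨m≡n t≤sk
  ... | inj₂ refl = recurrenceSum-top k
  recurrenceSum≡ zero zero _ | inj₁ _ = refl
  recurrenceSum≡ zero (suc t) _ | inj₁ (s≤s ())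
  recurrenceSum≡ (suc k) t _ | inj₁ (s≤s t≤k) = begin
    recurrenceSum (suc k) t                           ≡⟨ ∑-suc (suc k) (recurrenceTerm t) ⟩
    recurrenceSum k t + recurrenceTerm t (suc k)      ≡⟨ cong₂ _+_ (recurrenceSum≡ k t t≤k) last ⟩
    ι (suc k) * S 0 t + S 0 t
      ≡⟨ solve 2 (λ x a → x :* a :+ a := (con 1ℚ :+ x) :* a) refl (ι (suc k)) (S 0 t) ⟩
    (1ℚ + ι (suc k)) * S 0 t                          ≡⟨ cong (_* S 0 t) (ι-suc (suc k)) ⟨
    ι (suc (suc k)) * S 0 t ∎
    where
    last : recurrenceTerm t (suc k) ≡ S 0 t
    last rewrite ℕ.m≥n⇒m⊓n≡n t≤k | ≤⇒>ᵇ≡false t≤k =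
      trans (cong (S 0 t +_) (ℚ.*-zeroˡ (S 0 (t ∸ 1)))) (ℚ.+-identityʳ (S 0 t))

  avoidersByRank-closed : (k t : ℕ) → t ≤ k → ι (avoidersByRank k t) ≡ ι (k !) * S 0 t
  avoidersByRank-closed zero zero _ = refl
  avoidersByRank-closed (suc k) t t≤sk = begin
    ι (avoidersByRank (suc k) t)                    ≡⟨ ι-sum (suc k) term ⟩
    ∑[ r < suc k ] ι (term r)                       ≡⟨ ∑-cong< (suc k) by-IH ⟩
    ∑[ r < suc k ] (ι (k !) * recurrenceTerm t r)   ≡⟨ ∑-*ˡ (suc k) (ι (k !)) (recurrenceTerm t) ⟩
    ι (k !) * recurrenceSum k t                     ≡⟨ cong (ι (k !) *_) (recurrenceSum≡ k t t≤sk) ⟩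
    ι (k !) * (ι (suc k) * S 0 t)
      ≡⟨ solve 3 (λ a b x → a :* (b :* x) := (b :* a) :* x) refl (ι (k !)) (ι (suc k)) (S 0 t) ⟩
    ι (suc k) * ι (k !) * S 0 t                     ≡⟨ cong (_* S 0 t) (ι-* (suc k) (k !)) ⟨
    ι (suc k !) * S 0 t ∎
    where
    term : ℕ → ℕ
    term r = avoidersByRank k (r ⊓ t) +ℕ ⟦ r <ᵇ t ⟧ *ℕ avoidersByRank k (t ∸ 1)
    by-IH : ∀ {r} → r < suc k → ι (term r) ≡ ι (k !) * recurrenceTerm t r
    by-IH {r} (s≤s r≤k) = begin
      ι (term r)
        ≡⟨ trans (ι-+ (avoidersByRank k (r ⊓ t)) _)
                 (cong (ι (avoidersByRank k (r ⊓ t)) +_) (ι-* ⟦ r <ᵇ t ⟧ (avoidersByRank k (t ∸ 1)))) ⟩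
      ι (avoidersByRank k (r ⊓ t)) + ι ⟦ r <ᵇ t ⟧ * ι (avoidersByRank k (t ∸ 1))
        ≡⟨ cong₂ (λ x y → x + ι ⟦ r <ᵇ t ⟧ * y)
             (avoidersByRank-closed k (r ⊓ t) (ℕ.≤-trans (ℕ.m⊓n≤m r t) r≤k))
             (avoidersByRank-closed k (t ∸ 1) (ℕ.∸-monoˡ-≤ 1 t≤sk)) ⟩
      ι (k !) * S 0 (r ⊓ t) + ι ⟦ r <ᵇ t ⟧ * (ι (k !) * S 0 (t ∸ 1))
        ≡⟨ solve 4 (λ a x i y → a :* x :+ i :* (a :* y) := a :* (x :+ i :* y)) refl
             (ι (k !)) (S 0 (r ⊓ t)) (ι ⟦ r <ᵇ t ⟧) (S 0 (t ∸ 1)) ⟩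
      ι (k !) * recurrenceTerm t r ∎

  pow-xOver1-x-below : (k i : ℕ) → i < k → pow xOver1-x k i ≡ 0ℚ
  pow-xOver1-x-below (suc k) i i<sk =
    trans (sumTo≡∑ i term) (∑-zero (suc i) term (λ {j} j≤i → term-zero i i<sk j j≤i))
    where
    term : ℕ → ℚ
    term j = xOver1-x j * pow xOver1-x k (i ∸ j)
    term-zero : ∀ i → i < suc k → ∀ j → j < suc i → xOver1-x j * pow xOver1-x k (i ∸ j) ≡ 0ℚ
    term-zero i _ zero _ = ℚ.*-zeroˡ (pow xOver1-x k i)
    term-zero zero _ (suc j) (s≤s ())
    term-zero (suc i) (s≤s i<k) (suc j) _ =
      trans (ℚ.*-identityˡ _) (pow-xOver1-x-below k (i ∸ j) (ℕ.≤-<-trans (ℕ.m∸n≤m i j) i<k))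

  pow-xOver1-x-suc : (k n : ℕ) → pow xOver1-x (suc k) (suc n) ≡ ∑< (suc n) (pow xOver1-x k)
  pow-xOver1-x-suc k n = begin
    pow xOver1-x (suc k) (suc n)
      ≡⟨ sumTo≡∑ (suc n) (λ i → xOver1-x i * pow xOver1-x k (suc n ∸ i)) ⟩
    0ℚ * pow xOver1-x k (suc n) + ∑[ i < suc n ] (1ℚ * pow xOver1-x k (n ∸ i))
      ≡⟨ cong₂ _+_ (ℚ.*-zeroˡ (pow xOver1-x k (suc n)))
                   (∑-cong (suc n) (λ i → ℚ.*-identityˡ (pow xOver1-x k (n ∸ i)))) ⟩
    0ℚ + ∑[ i < suc n ] pow xOver1-x k (n ∸ i)
      ≡⟨ ℚ.+-identityˡ _ ⟩
    ∑[ i < suc n ] pow xOver1-x k (n ∸ i)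
      ≡⟨ ∑-reverse n (pow xOver1-x k) ⟩
    ∑< (suc n) (pow xOver1-x k) ∎

  -- The coefficient of xⁱ in Σₖ (x/(1−x))ᵏ/(m + k)!, and the coefficient of xⁿ in that series times 1/(1−x).
  shiftedExpCoeff : ℕ → ℕ → ℚ
  shiftedExpCoeff m i = ∑[ k < suc i ] (invFact (m +ℕ k) * pow xOver1-x k i)

  shiftedRhsCoeff : ℕ → ℕ → ℚ
  shiftedRhsCoeff m n = ∑< (suc n) (shiftedExpCoeff m)

  shiftedExpCoeff-suc : (m n : ℕ) → shiftedExpCoeff m (suc n) ≡ shiftedRhsCoeff (suc m) n
  shiftedExpCoeff-suc m n = begin
    shiftedExpCoeff m (suc n)
      ≡⟨ cong (_+ ∑< (suc n) F′) (ℚ.*-zeroʳ (invFact (m +ℕ 0))) ⟩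
    0ℚ + ∑[ k < suc n ] F′ k                          ≡⟨ ℚ.+-identityˡ _ ⟩
    ∑[ k < suc n ] F′ k                               ≡⟨ ∑-cong (suc n) expand ⟩
    ∑[ k < suc n ] ∑[ j < suc n ] F k j               ≡⟨ ∑-comm (suc n) (suc n) F ⟩
    ∑[ j < suc n ] ∑[ k < suc n ] F k j               ≡⟨ ∑-cong< (suc n) truncate ⟩
    shiftedRhsCoeff (suc m) n ∎
    where
    F′ : ℕ → ℚ
    F′ k = invFact (m +ℕ suc k) * pow xOver1-x (suc k) (suc n)
    F : ℕ → ℕ → ℚ
    F k j = invFact (suc m +ℕ k) * pow xOver1-x k j
    expand : ∀ k → F′ k ≡ ∑[ j < suc n ] F k j
    expand k = trans (cong₂ _*_ (cong invFact (ℕ.+-suc m k)) (pow-xOver1-x-suc k n))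
                     (sym (∑-*ˡ (suc n) (invFact (suc m +ℕ k)) (pow xOver1-x k)))
    truncate : ∀ {j} → j < suc n → ∑[ k < suc n ] F k j ≡ shiftedExpCoeff (suc m) j
    truncate {j} (s≤s j≤n) = trans (cong (λ x → ∑[ k < suc x ] F k j) (sym (ℕ.m+[n∸m]≡n j≤n)))
      (∑-vanishing-tail (suc j) (n ∸ j) (λ k → F k j)
        (λ {k} j<k → trans (cong (invFact (suc m +ℕ k) *_) (pow-xOver1-x-below k j j<k))
                           (ℚ.*-zeroʳ (invFact (suc m +ℕ k)))))

  shiftedRhsCoeff≡S : (n m : ℕ) → shiftedRhsCoeff m n ≡ S m n
  shiftedRhsCoeff≡S zero m = begin
    invFact (m +ℕ 0) * 1ℚ + 0ℚ + 0ℚ      ≡⟨ ℚ.+-identityʳ _ ⟩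
    invFact (m +ℕ 0) * 1ℚ + 0ℚ           ≡⟨ ℚ.+-identityʳ _ ⟩
    invFact (m +ℕ 0) * 1ℚ                ≡⟨ ℚ.*-identityʳ _ ⟩
    invFact (m +ℕ 0)                     ≡⟨ cong invFact (ℕ.+-identityʳ m) ⟩
    invFact m ∎
  shiftedRhsCoeff≡S (suc n) m = begin
    shiftedRhsCoeff m (suc n)
      ≡⟨ ∑-suc (suc n) (shiftedExpCoeff m) ⟩
    shiftedRhsCoeff m n + shiftedExpCoeff m (suc n)
      ≡⟨ cong (shiftedRhsCoeff m n +_) (shiftedExpCoeff-suc m n) ⟩
    shiftedRhsCoeff m n + shiftedRhsCoeff (suc m) n
      ≡⟨ cong₂ _+_ (shiftedRhsCoeff≡S n m) (shiftedRhsCoeff≡S n (suc m)) ⟩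
    S m (suc n) ∎

  rhs≡S : (n : ℕ) → (expS xOver1-x ⊛ geom) n ≡ S 0 n
  rhs≡S n = begin
    (expS xOver1-x ⊛ geom) n   ≡⟨ sumTo≡∑ n (λ i → expS xOver1-x i * geom (n ∸ i)) ⟩
    ∑[ i < suc n ] (expS xOver1-x i * 1ℚ)
      ≡⟨ ∑-cong (suc n) (λ i → trans (ℚ.*-identityʳ (expS xOver1-x i))
                                     (sumTo≡∑ i (λ k → invFact k * pow xOver1-x k i))) ⟩
    shiftedRhsCoeff 0 n        ≡⟨ shiftedRhsCoeff≡S n 0 ⟩
    S 0 n ∎

open import Defs using (A; egf; expS; xOver1-x; _⊛_; geom)
open import Data.Nat using (ℕ; _!)
open import Data.Nat.Properties using (≤-refl)
open import Data.Rational using (_*_)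
open import Relation.Binary.PropositionalEquality using (_≡_; cong; module ≡-Reasoning)
open Counting using (avoidersByRank; A≡avoidersByRank)
open Rationals using (ι; invFact; ι!*-*invFact)
open Coefficients using (S; egf≡ι*invFact; avoidersByRank-closed; rhs≡S)
open ≡-Reasoning

theorem3 : (n : ℕ) → egf A n ≡ (expS xOver1-x ⊛ geom) n
theorem3 n = begin
  egf A n                               ≡⟨ egf≡ι*invFact A n ⟩
  ι (A n) * invFact n                   ≡⟨ cong (λ a → ι a * invFact n) (A≡avoidersByRank n) ⟩
  ι (avoidersByRank n n) * invFact n    ≡⟨ cong (_* invFact n) (avoidersByRank-closed n n ≤-refl) ⟩
  ι (n !) * S 0 n * invFact n           ≡⟨ ι!*-*invFact n (S 0 n) ⟩
  S 0 n                                 ≡⟨ rhs≡S n ⟨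
  (expS xOver1-x ⊛ geom) n ∎
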